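{- Let $\mathbb{K}$ be a commutative ring, $F=\mathbb{K}\{x_1,\dots,x_m\}$, $n\ge1$, $h,k\in\mathbb{N}$, $\alpha\in\mathbb{N}^h$, $\beta\in\mathbb{N}^k$ with $|\alpha|,|\beta|\le n$, and $r_1,\dots,r_h,s_1,\dots,s_k\in F$. Then $$e^n_\alpha(r_1,\dots,r_h)\,e^n_\beta(s_1,\dots,s_k)=\sum_\gamma e^n_\gamma(r_1,\dots,r_h,s_1,\dots,s_k,r_1s_1,r_1s_2,\dots,r_1s_k,r_2s_1,\dots,r_hs_k),$$ where $\gamma=(\gamma_{10},\dots,\gamma_{h0},\gamma_{01},\dots,\gamma_{0k},\gamma_{11},\gamma_{12},\dots,\gamma_{hk})$ ranges over all tuples with $\gamma_{ij}\in\mathbb{N}$, $|\gamma|\le n$, $\sum_{j=0}^k\gamma_{ij}=\alpha_i$ for $i=1,\dots,h$, and $\sum_{i=0}^h\gamma_{ij}=\beta_j$ for $j=1,\dots,k$.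
   Context: For $f_1,\dots,f_p\in F$ and $\beta\in\mathbb{N}^p$, $e^n_\beta(f_1,\dots,f_p)\in(F^{\otimes n})^{S_n}$ is the coefficient of $t_1^{\beta_1}\cdots t_p^{\beta_p}$ in $(1\otimes1+\sum_{q}t_q\otimes f_q)^{\otimes n}\in\mathbb{K}[t_1,\dots,t_p]\otimes_{\mathbb{K}}F^{\otimes n}$ (the $t_q$ commuting indeterminates); $|\beta|=\sum\beta_q$. Products are taken in the algebra $F^{\otimes n}$. -}

module Defs where

open import Level using (Level)
open import Algebra.Bundles using (CommutativeRing)
open import Data.Nat as ℕ using (ℕ; zero; suc; _≡ᵇ_; _≤ᵇ_)
open import Data.Bool using (Bool; true; false; if_then_else_; _∧_)
open import Data.Fin as Fin using (Fin; zero; suc; splitAt; remQuot; combine; _↑ˡ_; _↑ʳ_)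
import Data.Fin.Properties as FinP
open import Data.Product using (_×_; _,_; proj₁; proj₂)
open import Data.Sum using (inj₁; inj₂)
open import Data.List as List using (List; []; _∷_; _++_; concatMap; upTo; allFin)
import Data.List.Properties as ListP
open import Data.Vec as Vec using (Vec; []; _∷_; lookup; tabulate)
import Data.Vec.Properties as VecP
open import Relation.Nullary.Decidable using (⌊_⌋)
open import Relation.Binary.Definitions using (DecidableEquality)

vecsOver : ∀ {a} {A : Set a} → List A → (n : ℕ) → List (Vec A n)
vecsOver xs zero    = [] ∷ []
vecsOver xs (suc n) = concatMap (λ x → List.map (x ∷_) (vecsOver xs n)) xs

boolFilter : ∀ {a} {A : Set a} → (A → Bool) → List A → List A
boolFilter P []       = []
boolFilter P (x ∷ xs) = if P x then x ∷ boolFilter P xs else boolFilter P xs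

Σℕ : (p : ℕ) → (Fin p → ℕ) → ℕ
Σℕ p f = Vec.sum (tabulate f)

allB : (p : ℕ) → (Fin p → Bool) → Bool
allB p f = Vec.foldr _ _∧_ true (tabulate f)

countFin : ∀ {p n} → Fin p → Vec (Fin p) n → ℕ
countFin a []       = 0
countFin a (x ∷ xs) = (if ⌊ x Fin.≟ a ⌋ then 1 else 0) ℕ.+ countFin a xs

-- The free associative algebra F = K{x_1,…,x_m} and its tensor powers
-- F^{⊗n}, as formal K-linear combinations of words (resp. n-tuples of
-- words), compared by their coefficient functions.

module Alg {c ℓ : Level} (K : CommutativeRing c ℓ) (m : ℕ) where
  open CommutativeRing K renaming (Carrier to R)

  Word : Set
  Word = List (Fin m)

  Basis : ℕ → Set
  Basis n = Vec Word n

  _≟B_ : ∀ {n} → DecidableEquality (Basis n)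
  _≟B_ = VecP.≡-dec (ListP.≡-dec FinP._≟_)

  F : Set c
  F = List (R × Word)

  T : ℕ → Set c
  T n = List (R × Basis n)

  coeff : ∀ {n} → T n → Basis n → R
  coeff []             w = 0#
  coeff ((x , u) ∷ as) w = if ⌊ u ≟B w ⌋ then x + coeff as w else coeff as w

  _≋_ : ∀ {n} → T n → T n → Set ℓ
  a ≋ b = ∀ w → coeff a w ≈ coeff b w

  _*F_ : F → F → F
  a *F b = concatMap (λ { (x , u) → List.map (λ { (y , v) → (x * y , u ++ v) }) b }) a

  oneF : F
  oneF = (1# , []) ∷ []

  _*T_ : ∀ {n} → T n → T n → T n
  a *T b = concatMap (λ { (x , u) → List.map (λ { (y , v) → (x * y , Vec.zipWith _++_ u v) }) b }) a

  ΣT : ∀ {a} {A : Set a} {n} → List A → (A → T n) → T n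
  ΣT xs f = concatMap f xs

  tensor : ∀ {n} → Vec F n → T n
  tensor []       = (1# , []) ∷ []
  tensor (f ∷ fs) = concatMap (λ { (x , w) → List.map (λ { (y , ws) → (x * y , w ∷ ws) }) (tensor fs) }) f

  -- e^n_β(f₁,…,f_p): coefficient of t^β in (1⊗1 + Σ_q t_q ⊗ f_q)^{⊗n}.
  -- Expanding the n-fold tensor power, a term is given by choosing in each
  -- tensor factor either 1 (choice zero) or t_q f_q (choice suc q); it
  -- contributes to t^β iff each q is chosen exactly β_q times.
  choice : ∀ {p} → Vec F p → Fin (suc p) → F
  choice f zero    = oneF
  choice f (suc q) = lookup f q

  e : (n : ℕ) {p : ℕ} → Vec ℕ p → Vec F p → T n
  e n {p} β f =
    ΣT (boolFilter (λ c → allB p (λ q → countFin (suc q) c ≡ᵇ lookup β q))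
                   (vecsOver (allFin (suc p)) n))
       (λ c → tensor (Vec.map (choice f) c))

  -- Data for the theorem.  Index set of γ: Fin (h + k + h * k), laid out
  -- as (γ_{10},…,γ_{h0}, γ_{01},…,γ_{0k}, γ_{11},γ_{12},…,γ_{hk}).

  idx-i0 : ∀ {h k} → Fin h → Fin (h ℕ.+ k ℕ.+ h ℕ.* k)
  idx-i0 {h} {k} i = (i ↑ˡ k) ↑ˡ (h ℕ.* k)

  idx-0j : ∀ {h k} → Fin k → Fin (h ℕ.+ k ℕ.+ h ℕ.* k)
  idx-0j {h} {k} j = (h ↑ʳ j) ↑ˡ (h ℕ.* k)

  idx-ij : ∀ {h k} → Fin h → Fin k → Fin (h ℕ.+ k ℕ.+ h ℕ.* k)
  idx-ij {h} {k} i j = (h ℕ.+ k) ↑ʳ combine i j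

  gens : ∀ {h k} → Vec F h → Vec F k → Vec F (h ℕ.+ k ℕ.+ h ℕ.* k)
  gens {h} {k} r s = tabulate g
    where
    g : Fin (h ℕ.+ k ℕ.+ h ℕ.* k) → F
    g t with splitAt (h ℕ.+ k) t
    ... | inj₂ ij with remQuot k ij
    ...   | (i , j) = lookup r i *F lookup s j
    g t | inj₁ t' with splitAt h t'
    ...   | inj₁ i = lookup r i
    ...   | inj₂ j = lookup s j

  admissible : ∀ {h k} (n : ℕ) → Vec ℕ h → Vec ℕ k → Vec ℕ (h ℕ.+ k ℕ.+ h ℕ.* k) → Bool
  admissible {h} {k} n α β γ =
    (Vec.sum γ ≤ᵇ n)
    ∧ allB h (λ i → (lookup γ (idx-i0 {h} {k} i) ℕ.+ Σℕ k (λ j → lookup γ (idx-ij {h} {k} i j))) ≡ᵇ lookup α i)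
    ∧ allB k (λ j → (lookup γ (idx-0j {h} {k} j) ℕ.+ Σℕ h (λ i → lookup γ (idx-ij {h} {k} i j))) ≡ᵇ lookup β j)

  admissibleγs : ∀ {h k} (n : ℕ) → Vec ℕ h → Vec ℕ k → List (Vec ℕ (h ℕ.+ k ℕ.+ h ℕ.* k))
  admissibleγs {h} {k} n α β =
    boolFilter (admissible n α β) (vecsOver (upTo (suc n)) (h ℕ.+ k ℕ.+ h ℕ.* k))

-- Expanding the tensor power, e^n_β(f) is the sum of the monomials f_{c₁} ⊗ ⋯ ⊗ f_{cₙ} over the
-- choice vectors c ∈ {0,…,p}ⁿ of multidegree β, where f₀ = 1.  A monomial of e^n_α(r) times one of
-- e^n_β(s) multiplies factorwise, so the pair of choice vectors (c, d) becomes the choice vector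
-- p = ((c₁,d₁),…,(cₙ,dₙ)) for the list 1, rᵢ, sⱼ, rᵢsⱼ.  This is a bijection, and the multidegree γ
-- of p has row sums α and column sums β exactly when c and d have multidegrees α and β.  On the
-- right-hand side every choice vector p occurs once, in the summand γ = multidegree p.  Elements of
-- F^{⊗n} are compared by pairing them with arbitrary functions on the tensor basis.

module Submission where

open import Defs
open import Algebra.Bundles using (CommutativeRing)
open import Data.Nat using (ℕ; _≤_)
open import Data.Vec using (Vec; sum)

open import Algebra.Bundles using (CommutativeSemiring)
import Algebra.Properties.CommutativeSemigroup as CommSemigroupProps
import Algebra.Properties.CommutativeMonoid.Sum as FinSum
open import Data.Bool using (Bool; true; false; if_then_else_; _∧_)
open import Data.Bool.Properties using (T-≡; ∧-comm)
open import Data.Empty using (⊥-elim)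
open import Data.Fin as Fin using (Fin; zero; suc; splitAt; remQuot; combine; _↑ˡ_; _↑ʳ_)
import Data.Fin.Properties as FinP
open import Data.List as List using (List; []; _∷_; _++_; concatMap; upTo; allFin)
open import Data.List.Properties using (++-identityʳ)
open import Data.List.Membership.Propositional using (_∈_)
open import Data.List.Membership.Propositional.Properties using (∈-upTo⁺)
open import Data.List.Relation.Unary.All as All using (All)
open import Data.List.Relation.Unary.AllPairs using (_∷_)
open import Data.List.Relation.Unary.Any using (here; there)
open import Data.List.Relation.Unary.Unique.Propositional using (Unique)
open import Data.List.Relation.Unary.Unique.Propositional.Properties using (upTo⁺)
open import Data.Nat as ℕ using (zero; suc; _≡ᵇ_)
import Data.Nat.Properties as ℕP
open import Data.Product using (_×_; _,_; proj₁; proj₂)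
import Data.Product as Product
open import Data.Product.Properties using (,-injective)
open import Data.Sum using ([_,_]′)
import Data.Vec as V
open V using ([]; _∷_; lookup; tabulate; zipWith)
import Data.Vec.Properties as VecP
open import Function using (id; _∘_; _∋_; flip)
open import Function.Bundles using (Equivalence)
open import Level using (_⊔_)
open import Relation.Binary.PropositionalEquality as ≡ using (_≡_; _≢_; refl; cong; cong₂; ≢-sym)
open import Relation.Nullary.Decidable using (yes; no; ⌊_⌋; dec-true; dec-false)

δ : ∀ {p} → Fin p → Fin p → ℕ
δ x a = if ⌊ x Fin.≟ a ⌋ then 1 else 0

δ-refl : ∀ {p} (x : Fin p) → δ x x ≡ 1
δ-refl x with x Fin.≟ x
... | yes _   = refl
... | no x≢x = ⊥-elim (x≢x refl)

δ-≢ : ∀ {p} {x a : Fin p} → x ≢ a → δ x a ≡ 0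
δ-≢ {x = x} {a} x≢a with x Fin.≟ a
... | yes x≡a = ⊥-elim (x≢a x≡a)
... | no _    = refl

δ-injective : ∀ {p q} (f : Fin p → Fin q) → (∀ {x y} → f x ≡ f y → x ≡ y) →
              ∀ x y → δ (f x) (f y) ≡ δ x y
δ-injective f f-inj x y with x Fin.≟ y
... | yes refl = δ-refl (f x)
... | no x≢y   = δ-≢ (x≢y ∘ f-inj)

δ≤1 : ∀ {p} (x a : Fin p) → δ x a ≤ 1
δ≤1 x a with ⌊ x Fin.≟ a ⌋
... | true  = ℕP.≤-refl
... | false = ℕ.z≤n

Σℕ-cong : ∀ p {f g : Fin p → ℕ} → (∀ q → f q ≡ g q) → Σℕ p f ≡ Σℕ p g
Σℕ-cong p f≗g = cong V.sum (VecP.tabulate-cong f≗g)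

Σℕ-zero : ∀ p {f : Fin p → ℕ} → (∀ q → f q ≡ 0) → Σℕ p f ≡ 0
Σℕ-zero zero    f≗0 = refl
Σℕ-zero (suc p) f≗0 = cong₂ ℕ._+_ (f≗0 zero) (Σℕ-zero p (f≗0 ∘ suc))

Σℕ-distrib-+ : ∀ p (f g : Fin p → ℕ) → Σℕ p (λ q → f q ℕ.+ g q) ≡ Σℕ p f ℕ.+ Σℕ p g
Σℕ-distrib-+ zero    f g = refl
Σℕ-distrib-+ (suc p) f g =
  ≡.trans (cong (f zero ℕ.+ g zero ℕ.+_) (Σℕ-distrib-+ p (f ∘ suc) (g ∘ suc)))
          (CommSemigroupProps.interchange ℕP.+-commutativeSemigroup
             (f zero) (g zero) (Σℕ p (f ∘ suc)) (Σℕ p (g ∘ suc)))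

Σℕ-δ : ∀ {p} (x : Fin p) → Σℕ p (δ x) ≡ 1
Σℕ-δ {suc p} zero    = cong suc (Σℕ-zero p (λ _ → refl))
Σℕ-δ {suc p} (suc x) = ≡.trans (Σℕ-cong p (δ-injective suc FinP.suc-injective x)) (Σℕ-δ x)

countFin≤length : ∀ {p n} (a : Fin p) (xs : Vec (Fin p) n) → countFin a xs ≤ n
countFin≤length a []       = ℕ.z≤n
countFin≤length a (x ∷ xs) = ℕP.+-mono-≤ (δ≤1 x a) (countFin≤length a xs)

Σℕ-countFin : ∀ {p n} (xs : Vec (Fin p) n) → Σℕ p (λ a → countFin a xs) ≡ n
Σℕ-countFin {p} []       = Σℕ-zero p (λ _ → refl)
Σℕ-countFin {p} (x ∷ xs) =
  ≡.trans (Σℕ-distrib-+ p (δ x) (λ a → countFin a xs)) (cong₂ ℕ._+_ (Σℕ-δ x) (Σℕ-countFin xs))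

module _ {p q r : ℕ} (π : Fin p → Fin q → Fin r)
         (π-injective : ∀ {a b a′ b′} → π a b ≡ π a′ b′ → a ≡ a′ × b ≡ b′) where

  Σℕ-δ-π : ∀ x y a → Σℕ q (λ b → δ (π x y) (π a b)) ≡ δ x a
  Σℕ-δ-π x y a with x Fin.≟ a
  ... | yes refl = ≡.trans (Σℕ-cong q (δ-injective (π x) (proj₂ ∘ π-injective) y)) (Σℕ-δ y)
  ... | no x≢a   = Σℕ-zero q (λ b → δ-≢ (x≢a ∘ proj₁ ∘ π-injective))

  countFin-marginalˡ : ∀ {n} (c : Vec (Fin p) n) d a →
                      Σℕ q (λ b → countFin (π a b) (zipWith π c d)) ≡ countFin a c
  countFin-marginalˡ []      []      a = Σℕ-zero q (λ _ → refl)
  countFin-marginalˡ (x ∷ c) (y ∷ d) a =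
    ≡.trans (Σℕ-distrib-+ q _ _) (cong₂ ℕ._+_ (Σℕ-δ-π x y a) (countFin-marginalˡ c d a))

countFin-marginalʳ : ∀ {p q r n} (π : Fin p → Fin q → Fin r) →
                     (∀ {a b a′ b′} → π a b ≡ π a′ b′ → a ≡ a′ × b ≡ b′) →
                     ∀ (c : Vec (Fin p) n) d b →
                     Σℕ p (λ a → countFin (π a b) (zipWith π c d)) ≡ countFin b d
countFin-marginalʳ π π-injective c d b
  rewrite VecP.zipWith-comm {f = π} {g = flip π} (λ _ _ → refl) c d =
  countFin-marginalˡ (flip π) (Product.swap ∘ π-injective) d c b

multidegree : ∀ {p n} → Vec (Fin (suc p)) n → Vec ℕ p
multidegree c = tabulate (λ q → countFin (suc q) c)

hasMultidegree : ∀ {p n} → Vec ℕ p → Vec (Fin (suc p)) n → Bool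
hasMultidegree {p} β c = allB p (λ q → countFin (suc q) c ≡ᵇ lookup β q)

sum-multidegree≤length : ∀ {p n} (xs : Vec (Fin (suc p)) n) → sum (multidegree xs) ≤ n
sum-multidegree≤length xs =
  ℕP.≤-trans (ℕP.m≤n+m _ (countFin zero xs)) (ℕP.≤-reflexive (Σℕ-countFin xs))

allB-cong : ∀ p {f g : Fin p → Bool} → (∀ q → f q ≡ g q) → allB p f ≡ allB p g
allB-cong p f≗g = cong (V.foldr _ _∧_ true) (VecP.tabulate-cong f≗g)

module Sums {c ℓ} (S : CommutativeSemiring c ℓ) where
  open CommutativeSemiring S renaming (Carrier to R; refl to ≈-refl) hiding (zero)
  open CommSemigroupProps +-commutativeSemigroup using (interchange)
  open CommSemigroupProps *-commutativeSemigroup using (x∙yz≈y∙xz)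
  open FinSum +-commutativeMonoid using (sum-syntax)
  open import Relation.Binary.Reasoning.Setoid setoid

  ΣL : ∀ {i} {A : Set i} → List A → (A → R) → R
  ΣL []       f = 0#
  ΣL (x ∷ xs) f = f x + ΣL xs f

  infix 5 ΣL
  syntax ΣL xs (λ x → e) = Σ[ x ← xs ] e

  ΣL-cong : ∀ {i} {A : Set i} (xs : List A) {f g : A → R} → (∀ x → f x ≈ g x) → ΣL xs f ≈ ΣL xs g
  ΣL-cong []       f≈g = ≈-refl
  ΣL-cong (x ∷ xs) f≈g = +-cong (f≈g x) (ΣL-cong xs f≈g)

  ΣL-++ : ∀ {i} {A : Set i} (xs ys : List A) (f : A → R) → ΣL (xs ++ ys) f ≈ ΣL xs f + ΣL ys f
  ΣL-++ []       ys f = sym (+-identityˡ _)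
  ΣL-++ (x ∷ xs) ys f = trans (+-congˡ (ΣL-++ xs ys f)) (sym (+-assoc _ _ _))

  ΣL-map : ∀ {i j} {A : Set i} {B : Set j} (g : A → B) (xs : List A) (f : B → R) →
           ΣL (List.map g xs) f ≡ ΣL xs (f ∘ g)
  ΣL-map g []       f = refl
  ΣL-map g (x ∷ xs) f = cong (f (g x) +_) (ΣL-map g xs f)

  ΣL-concatMap : ∀ {i j} {A : Set i} {B : Set j} (g : A → List B) (xs : List A) (f : B → R) →
                 ΣL (concatMap g xs) f ≈ Σ[ x ← xs ] ΣL (g x) f
  ΣL-concatMap g []       f = ≈-refl
  ΣL-concatMap g (x ∷ xs) f = trans (ΣL-++ (g x) (concatMap g xs) f) (+-congˡ (ΣL-concatMap g xs f))

  ΣL-distrib-+ : ∀ {i} {A : Set i} (xs : List A) (f g : A → R) → Σ[ x ← xs ] (f x + g x) ≈ ΣL xs f + ΣL xs g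
  ΣL-distrib-+ []       f g = sym (+-identityˡ 0#)
  ΣL-distrib-+ (x ∷ xs) f g = trans (+-congˡ (ΣL-distrib-+ xs f g)) (interchange _ _ _ _)

  ΣL-zero : ∀ {i} {A : Set i} (xs : List A) → Σ[ x ← xs ] 0# ≈ 0#
  ΣL-zero []       = ≈-refl
  ΣL-zero (x ∷ xs) = trans (+-identityˡ _) (ΣL-zero xs)

  *-distribˡ-ΣL : ∀ {i} {A : Set i} (y : R) (xs : List A) (f : A → R) → y * ΣL xs f ≈ Σ[ x ← xs ] (y * f x)
  *-distribˡ-ΣL y []       f = zeroʳ y
  *-distribˡ-ΣL y (x ∷ xs) f = trans (distribˡ y _ _) (+-congˡ (*-distribˡ-ΣL y xs f))

  ΣL-comm : ∀ {i j} {A : Set i} {B : Set j} (xs : List A) (ys : List B) (f : A → B → R) →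
            Σ[ x ← xs ] Σ[ y ← ys ] f x y ≈ Σ[ y ← ys ] Σ[ x ← xs ] f x y
  ΣL-comm []       ys f = sym (ΣL-zero ys)
  ΣL-comm (x ∷ xs) ys f =
    trans (+-congˡ (ΣL-comm xs ys f)) (sym (ΣL-distrib-+ ys (f x) (λ y → Σ[ x′ ← xs ] f x′ y)))

  ΣL-tabulate : ∀ {A : Set} n (g : Fin n → A) (f : A → R) → ΣL (List.tabulate g) f ≡ ∑[ i < n ] f (g i)
  ΣL-tabulate zero    g f = refl
  ΣL-tabulate (suc n) g f = cong (f (g zero) +_) (ΣL-tabulate n (g ∘ suc) f)

  ΣL-allFin : ∀ n (f : Fin n → R) → ΣL (allFin n) f ≡ ∑[ i < n ] f i
  ΣL-allFin n = ΣL-tabulate n id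

  ∑-↑ : ∀ a b (f : Fin (a ℕ.+ b) → R) →
        ∑[ t < a ℕ.+ b ] f t ≈ ∑[ i < a ] f (i ↑ˡ b) + ∑[ j < b ] f (a ↑ʳ j)
  ∑-↑ zero    b f = sym (+-identityˡ _)
  ∑-↑ (suc a) b f = trans (+-congˡ (∑-↑ a b (f ∘ suc))) (sym (+-assoc _ _ _))

  ∑-combine : ∀ a b (f : Fin (a ℕ.* b) → R) →
              ∑[ t < a ℕ.* b ] f t ≈ ∑[ i < a ] ∑[ j < b ] f (combine i j)
  ∑-combine zero    b f = ≈-refl
  ∑-combine (suc a) b f = trans (∑-↑ b (a ℕ.* b) f) (+-congˡ (∑-combine a b (f ∘ (b ↑ʳ_))))

  [_]·_ : Bool → R → R
  [ b ]· x = if b then x else 0#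

  infixr 5 [_]·_

  []·-cong : ∀ b {x y} → x ≈ y → [ b ]· x ≈ [ b ]· y
  []·-cong true  x≈y = x≈y
  []·-cong false x≈y = ≈-refl

  []·-∧ : ∀ a b x → [ a ∧ b ]· x ≡ [ a ]· [ b ]· x
  []·-∧ true  b x = refl
  []·-∧ false b x = refl

  []·-comm : ∀ a b x → [ a ]· [ b ]· x ≡ [ b ]· [ a ]· x
  []·-comm a b x = ≡.trans (≡.sym ([]·-∧ a b x)) (≡.trans (cong ([_]· x) (∧-comm a b)) ([]·-∧ b a x))

  ΣL-[]· : ∀ {i} {A : Set i} b (xs : List A) (f : A → R) → Σ[ x ← xs ] [ b ]· f x ≈ [ b ]· ΣL xs f
  ΣL-[]· true  xs f = ≈-refl
  ΣL-[]· false xs f = ΣL-zero xs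

  ΣL-boolFilter : ∀ {A : Set} (P : A → Bool) (xs : List A) (f : A → R) →
                  ΣL (boolFilter P xs) f ≈ Σ[ x ← xs ] [ P x ]· f x
  ΣL-boolFilter P []       f = ≈-refl
  ΣL-boolFilter P (x ∷ xs) f with P x
  ... | true  = +-congˡ (ΣL-boolFilter P xs f)
  ... | false = trans (ΣL-boolFilter P xs f) (sym (+-identityˡ _))

  ΣL-boolFilter² : ∀ {A B : Set} (P : A → Bool) (Q : B → Bool) (xs : List A) (ys : List B) (f : A → B → R) →
                   Σ[ x ← boolFilter P xs ] Σ[ y ← boolFilter Q ys ] f x y ≈
                   Σ[ x ← xs ] Σ[ y ← ys ] [ P x ∧ Q y ]· f x y
  ΣL-boolFilter² P Q xs ys f = begin
    Σ[ x ← boolFilter P xs ] Σ[ y ← boolFilter Q ys ] f x y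
      ≈⟨ ΣL-boolFilter P xs _ ⟩
    Σ[ x ← xs ] [ P x ]· Σ[ y ← boolFilter Q ys ] f x y
      ≈⟨ ΣL-cong xs (λ x → []·-cong (P x) (ΣL-boolFilter Q ys _)) ⟩
    Σ[ x ← xs ] [ P x ]· Σ[ y ← ys ] [ Q y ]· f x y
      ≈⟨ ΣL-cong xs (λ x → sym (ΣL-[]· (P x) ys _)) ⟩
    Σ[ x ← xs ] Σ[ y ← ys ] [ P x ]· [ Q y ]· f x y
      ≈⟨ ΣL-cong xs (λ x → ΣL-cong ys (λ y → reflexive ([]·-∧ (P x) (Q y) (f x y)))) ⟨
    Σ[ x ← xs ] Σ[ y ← ys ] [ P x ∧ Q y ]· f x y ∎

  ΣL-≡ᵇ-∉ : ∀ v {U : List ℕ} (W : ℕ → R) → All (v ≢_) U → Σ[ x ← U ] [ v ≡ᵇ x ]· W x ≈ 0#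
  ΣL-≡ᵇ-∉ v W All.[]            = ≈-refl
  ΣL-≡ᵇ-∉ v {x ∷ U} W (v≢x All.∷ v∉U) =
    trans (+-cong (reflexive (cong (λ b → [ b ]· W x) (dec-false (v ℕP.≟ x) v≢x))) (ΣL-≡ᵇ-∉ v W v∉U))
          (+-identityˡ 0#)

  ΣL-≡ᵇ : ∀ {v} {U : List ℕ} (W : ℕ → R) → Unique U → v ∈ U → Σ[ x ← U ] [ v ≡ᵇ x ]· W x ≈ W v
  ΣL-≡ᵇ {v} W (v∉U ∷ _) (here refl) =
    trans (+-cong (reflexive (cong (λ b → [ b ]· W v) (dec-true (v ℕP.≟ v) refl))) (ΣL-≡ᵇ-∉ v W v∉U))
          (+-identityʳ _)
  ΣL-≡ᵇ {v} {x ∷ U} W (x∉U ∷ U-unique) (there v∈U) =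
    trans (+-cong (reflexive (cong (λ b → [ b ]· W x) (dec-false (v ℕP.≟ x) (≢-sym (All.lookup x∉U v∈U)))))
                  (ΣL-≡ᵇ W U-unique v∈U))
          (+-identityˡ _)

  ΣL-vecsOver-suc : ∀ {A : Set} (xs : List A) n (f : Vec A (suc n) → R) →
                    ΣL (vecsOver xs (suc n)) f ≈ Σ[ x ← xs ] Σ[ v ← vecsOver xs n ] f (x ∷ v)
  ΣL-vecsOver-suc xs n f =
    trans (ΣL-concatMap _ xs f) (ΣL-cong xs (λ x → reflexive (ΣL-map (x ∷_) (vecsOver xs n) f)))

  ΣL-vecsOver-≡ᵇ : ∀ {U : List ℕ} N (f : Fin N → ℕ) (Z : Vec ℕ N → R) → Unique U → (∀ q → f q ∈ U) →
                   Σ[ γ ← vecsOver U N ] [ allB N (λ q → f q ≡ᵇ lookup γ q) ]· Z γ ≈ Z (tabulate f)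
  ΣL-vecsOver-≡ᵇ zero    f Z U-unique f∈U = +-identityʳ _
  ΣL-vecsOver-≡ᵇ {U} (suc N) f Z U-unique f∈U = begin
    Σ[ γ ← vecsOver U (suc N) ] [ allB (suc N) (λ q → f q ≡ᵇ lookup γ q) ]· Z γ
      ≈⟨ ΣL-vecsOver-suc U N _ ⟩
    Σ[ x ← U ] Σ[ γ ← vecsOver U N ] [ (f zero ≡ᵇ x) ∧ allB N (λ q → f (suc q) ≡ᵇ lookup γ q) ]· Z (x ∷ γ)
      ≈⟨ ΣL-cong U (λ x → ΣL-cong (vecsOver U N) (λ γ → reflexive ([]·-∧ (f zero ≡ᵇ x) _ _))) ⟩
    Σ[ x ← U ] Σ[ γ ← vecsOver U N ] [ f zero ≡ᵇ x ]· [ allB N (λ q → f (suc q) ≡ᵇ lookup γ q) ]· Z (x ∷ γ)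
      ≈⟨ ΣL-cong U (λ x → ΣL-[]· (f zero ≡ᵇ x) (vecsOver U N) _) ⟩
    Σ[ x ← U ] [ f zero ≡ᵇ x ]· Σ[ γ ← vecsOver U N ] [ allB N (λ q → f (suc q) ≡ᵇ lookup γ q) ]· Z (x ∷ γ)
      ≈⟨ ΣL-cong U (λ x → []·-cong (f zero ≡ᵇ x)
           (ΣL-vecsOver-≡ᵇ N (f ∘ suc) (Z ∘ (x ∷_)) U-unique (f∈U ∘ suc))) ⟩
    Σ[ x ← U ] [ f zero ≡ᵇ x ]· Z (x ∷ tabulate (f ∘ suc))
      ≈⟨ ΣL-≡ᵇ (λ x → Z (x ∷ tabulate (f ∘ suc))) U-unique (f∈U zero) ⟩
    Z (tabulate f) ∎

  ΣL-vecsOver-zipWith : ∀ {A B C : Set} (π : A → B → C) (as : List A) (bs : List B) (cs : List C) →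
    (∀ H → Σ[ a ← as ] Σ[ b ← bs ] H (π a b) ≈ ΣL cs H) →
    ∀ n (F : Vec C n → R) →
    Σ[ u ← vecsOver as n ] Σ[ v ← vecsOver bs n ] F (zipWith π u v) ≈ ΣL (vecsOver cs n) F
  ΣL-vecsOver-zipWith π as bs cs π-bijective zero    F = +-identityʳ _
  ΣL-vecsOver-zipWith π as bs cs π-bijective (suc n) F = begin
    Σ[ u ← vecsOver as (suc n) ] Σ[ v ← vecsOver bs (suc n) ] F (zipWith π u v)
      ≈⟨ ΣL-vecsOver-suc as n _ ⟩
    Σ[ a ← as ] Σ[ u ← vecsOver as n ] Σ[ v ← vecsOver bs (suc n) ] F (zipWith π (a ∷ u) v)
      ≈⟨ ΣL-cong as (λ a → ΣL-cong (vecsOver as n) (λ u → ΣL-vecsOver-suc bs n _)) ⟩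
    Σ[ a ← as ] Σ[ u ← vecsOver as n ] Σ[ b ← bs ] Σ[ v ← vecsOver bs n ] F (π a b ∷ zipWith π u v)
      ≈⟨ ΣL-cong as (λ a → ΣL-comm (vecsOver as n) bs _) ⟩
    Σ[ a ← as ] Σ[ b ← bs ] Σ[ u ← vecsOver as n ] Σ[ v ← vecsOver bs n ] F (π a b ∷ zipWith π u v)
      ≈⟨ ΣL-cong as (λ a → ΣL-cong bs (λ b →
           ΣL-vecsOver-zipWith π as bs cs π-bijective n (F ∘ (π a b ∷_)))) ⟩
    Σ[ a ← as ] Σ[ b ← bs ] Σ[ w ← vecsOver cs n ] F (π a b ∷ w)
      ≈⟨ π-bijective (λ z → Σ[ w ← vecsOver cs n ] F (z ∷ w)) ⟩
    Σ[ z ← cs ] Σ[ w ← vecsOver cs n ] F (z ∷ w)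
      ≈⟨ ΣL-vecsOver-suc cs n F ⟨
    ΣL (vecsOver cs (suc n)) F ∎

  ⟪_∣_⟫ : {B : Set} → List (R × B) → (B → R) → R
  ⟪ a ∣ g ⟫ = ΣL a (λ (x , u) → x * g u)

  _≐_ : {B : Set} → List (R × B) → List (R × B) → Set (c ⊔ ℓ)
  a ≐ b = ∀ g → ⟪ a ∣ g ⟫ ≈ ⟪ b ∣ g ⟫

  infix 4 _≐_

  ⟪⟫-unit : {B : Set} (u : B) (g : B → R) → ⟪ (1# , u) ∷ [] ∣ g ⟫ ≈ g u
  ⟪⟫-unit u g = trans (+-identityʳ _) (*-identityˡ _)

  -- _*F_, _*T_ and tensor (f ∷ fs) are definitionally lift₂ _++_, lift₂ (zipWith _++_) and
  -- lift₂ _∷_ f (tensor fs).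
  lift₂ : {B₁ B₂ B₃ : Set} → (B₁ → B₂ → B₃) → List (R × B₁) → List (R × B₂) → List (R × B₃)
  lift₂ op a b = concatMap (λ (x , u) → List.map (λ (y , v) → (x * y , op u v)) b) a

  ⟪⟫-cong : {B : Set} (a : List (R × B)) {g g′ : B → R} → (∀ u → g u ≈ g′ u) →
            ⟪ a ∣ g ⟫ ≈ ⟪ a ∣ g′ ⟫
  ⟪⟫-cong a g≈g′ = ΣL-cong a (λ (x , u) → *-congˡ (g≈g′ u))

  ⟪⟫-concatMap : ∀ {i} {A : Set i} {B : Set} (f : A → List (R × B)) (xs : List A) (g : B → R) →
                 ⟪ concatMap f xs ∣ g ⟫ ≈ Σ[ x ← xs ] ⟪ f x ∣ g ⟫
  ⟪⟫-concatMap f xs g = ΣL-concatMap f xs _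

  ⟪⟫-ΣL : ∀ {i} {A : Set i} {B : Set} (a : List (R × B)) (ys : List A) (G : A → B → R) →
          ⟪ a ∣ (λ u → Σ[ y ← ys ] G y u) ⟫ ≈ Σ[ y ← ys ] ⟪ a ∣ G y ⟫
  ⟪⟫-ΣL a ys G = trans (ΣL-cong a (λ (x , u) → *-distribˡ-ΣL x ys (λ y → G y u))) (ΣL-comm a ys _)

  ⟪⟫-lift₂ : {B₁ B₂ B₃ : Set} (op : B₁ → B₂ → B₃) (a : List (R × B₁)) (b : List (R × B₂))
             (g : B₃ → R) →
             ⟪ lift₂ op a b ∣ g ⟫ ≈ ⟪ a ∣ (λ u → ⟪ b ∣ (λ v → g (op u v)) ⟫) ⟫
  ⟪⟫-lift₂ op a b g = begin
    ⟪ lift₂ op a b ∣ g ⟫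
      ≈⟨ ΣL-concatMap _ a _ ⟩
    Σ[ (x , u) ← a ] ΣL (List.map (λ (y , v) → (x * y , op u v)) b) (λ (z , w) → z * g w)
      ≈⟨ ΣL-cong a (λ (x , u) → reflexive (ΣL-map _ b _)) ⟩
    Σ[ (x , u) ← a ] Σ[ (y , v) ← b ] (x * y) * g (op u v)
      ≈⟨ ΣL-cong a (λ (x , u) → ΣL-cong b (λ (y , v) → *-assoc x y _)) ⟩
    Σ[ (x , u) ← a ] Σ[ (y , v) ← b ] x * (y * g (op u v))
      ≈⟨ ΣL-cong a (λ (x , u) → *-distribˡ-ΣL x b _) ⟨
    ⟪ a ∣ (λ u → ⟪ b ∣ (λ v → g (op u v)) ⟫) ⟫ ∎

  ⟪⟫-comm : {B₁ B₂ : Set} (a : List (R × B₁)) (b : List (R × B₂)) (H : B₁ → B₂ → R) →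
            ⟪ a ∣ (λ u → ⟪ b ∣ H u ⟫) ⟫ ≈ ⟪ b ∣ (λ v → ⟪ a ∣ (λ u → H u v) ⟫) ⟫
  ⟪⟫-comm a b H = begin
    ⟪ a ∣ (λ u → ⟪ b ∣ H u ⟫) ⟫
      ≈⟨ ΣL-cong a (λ (x , u) → *-distribˡ-ΣL x b _) ⟩
    Σ[ (x , u) ← a ] Σ[ (y , v) ← b ] x * (y * H u v)
      ≈⟨ ΣL-comm a b _ ⟩
    Σ[ (y , v) ← b ] Σ[ (x , u) ← a ] x * (y * H u v)
      ≈⟨ ΣL-cong b (λ (y , v) → ΣL-cong a (λ (x , u) → x∙yz≈y∙xz x y _)) ⟩
    Σ[ (y , v) ← b ] Σ[ (x , u) ← a ] y * (x * H u v)
      ≈⟨ ΣL-cong b (λ (y , v) → *-distribˡ-ΣL y a _) ⟨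
    ⟪ b ∣ (λ v → ⟪ a ∣ (λ u → H u v) ⟫) ⟫ ∎

  ⟪⟫-lift₂-bilinear : ∀ {i j} {A₁ : Set i} {A₂ : Set j} {B₁ B₂ B₃ : Set} (op : B₁ → B₂ → B₃)
                      (f : A₁ → List (R × B₁)) (f′ : A₂ → List (R × B₂)) xs ys (g : B₃ → R) →
                      ⟪ lift₂ op (concatMap f xs) (concatMap f′ ys) ∣ g ⟫ ≈
                      Σ[ x ← xs ] Σ[ y ← ys ] ⟪ lift₂ op (f x) (f′ y) ∣ g ⟫
  ⟪⟫-lift₂-bilinear op f f′ xs ys g = begin
    ⟪ lift₂ op (concatMap f xs) (concatMap f′ ys) ∣ g ⟫
      ≈⟨ ⟪⟫-lift₂ op (concatMap f xs) (concatMap f′ ys) g ⟩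
    ⟪ concatMap f xs ∣ (λ u → ⟪ concatMap f′ ys ∣ (λ v → g (op u v)) ⟫) ⟫
      ≈⟨ ⟪⟫-cong (concatMap f xs) (λ u → ⟪⟫-concatMap f′ ys _) ⟩
    ⟪ concatMap f xs ∣ (λ u → Σ[ y ← ys ] ⟪ f′ y ∣ (λ v → g (op u v)) ⟫) ⟫
      ≈⟨ ⟪⟫-concatMap f xs _ ⟩
    Σ[ x ← xs ] ⟪ f x ∣ (λ u → Σ[ y ← ys ] ⟪ f′ y ∣ (λ v → g (op u v)) ⟫) ⟫
      ≈⟨ ΣL-cong xs (λ x → ⟪⟫-ΣL (f x) ys _) ⟩
    Σ[ x ← xs ] Σ[ y ← ys ] ⟪ f x ∣ (λ u → ⟪ f′ y ∣ (λ v → g (op u v)) ⟫) ⟫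
      ≈⟨ ΣL-cong xs (λ x → ΣL-cong ys (λ y → ⟪⟫-lift₂ op (f x) (f′ y) g)) ⟨
    Σ[ x ← xs ] Σ[ y ← ys ] ⟪ lift₂ op (f x) (f′ y) ∣ g ⟫ ∎

module Expansion {c ℓ} (K : CommutativeRing c ℓ) (m : ℕ) where
  open CommutativeRing K renaming (Carrier to R; refl to ≈-refl) hiding (zero)
  open Alg K m
  open Sums commutativeSemiring
  open import Relation.Binary.Reasoning.Setoid setoid

  *F-identityˡ : ∀ f → oneF *F f ≐ f
  *F-identityˡ f g = trans (⟪⟫-lift₂ _++_ oneF f g) (⟪⟫-unit [] (λ u → ⟪ f ∣ (λ v → g (u ++ v)) ⟫))

  *F-identityʳ : ∀ f → f *F oneF ≐ f
  *F-identityʳ f g =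
    trans (⟪⟫-lift₂ _++_ f oneF g)
          (⟪⟫-cong f (λ u → trans (⟪⟫-unit [] (λ v → g (u ++ v))) (reflexive (cong g (++-identityʳ u)))))

  tensor-*T : ∀ {n} (fs fs′ : Vec F n) → tensor fs *T tensor fs′ ≐ tensor (zipWith _*F_ fs fs′)
  tensor-*T [] [] g =
    trans (⟪⟫-lift₂ (zipWith _++_) (tensor []) (tensor []) g)
          (trans (⟪⟫-unit [] (λ u → ⟪ tensor [] ∣ (λ v → g (zipWith _++_ u v)) ⟫))
                 (trans (⟪⟫-unit [] (λ v → g (zipWith _++_ [] v))) (sym (⟪⟫-unit [] g))))
  tensor-*T {suc n} (f ∷ fs) (f′ ∷ fs′) g = begin
    ⟪ tensor (f ∷ fs) *T tensor (f′ ∷ fs′) ∣ g ⟫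
      ≈⟨ ⟪⟫-lift₂ (zipWith _++_) (tensor (f ∷ fs)) (tensor (f′ ∷ fs′)) g ⟩
    ⟪ tensor (f ∷ fs) ∣ (λ u → ⟪ tensor (f′ ∷ fs′) ∣ (λ v → g (zipWith _++_ u v)) ⟫) ⟫
      ≈⟨ ⟪⟫-lift₂ _∷_ f (tensor fs) _ ⟩
    ⟪ f ∣ (λ w → ⟪ tensor fs ∣ (λ ws → ⟪ tensor (f′ ∷ fs′) ∣ (λ v → g (zipWith _++_ (w ∷ ws) v)) ⟫) ⟫) ⟫
      ≈⟨ ⟪⟫-cong f (λ w → ⟪⟫-cong (tensor fs) (λ ws → ⟪⟫-lift₂ _∷_ f′ (tensor fs′) _)) ⟩
    ⟪ f ∣ (λ w → ⟪ tensor fs ∣ (λ ws → ⟪ f′ ∣ (λ w′ → ⟪ tensor fs′ ∣ g′ w w′ ws ⟫) ⟫) ⟫) ⟫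
      ≈⟨ ⟪⟫-cong f (λ w → ⟪⟫-comm (tensor fs) f′ _) ⟩
    ⟪ f ∣ (λ w → ⟪ f′ ∣ (λ w′ → ⟪ tensor fs ∣ (λ ws → ⟪ tensor fs′ ∣ g′ w w′ ws ⟫) ⟫) ⟫) ⟫
      ≈⟨ ⟪⟫-cong f (λ w → ⟪⟫-cong f′ (λ w′ →
           trans (sym (⟪⟫-lift₂ (zipWith _++_) (tensor fs) (tensor fs′) _)) (tensor-*T fs fs′ _))) ⟩
    ⟪ f ∣ (λ w → ⟪ f′ ∣ (λ w′ → ⟪ tensor (zipWith _*F_ fs fs′) ∣ (λ zs → g ((w ++ w′) ∷ zs)) ⟫) ⟫) ⟫
      ≈⟨ ⟪⟫-lift₂ _++_ f f′ _ ⟨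
    ⟪ f *F f′ ∣ (λ z → ⟪ tensor (zipWith _*F_ fs fs′) ∣ (λ zs → g (z ∷ zs)) ⟫) ⟫
      ≈⟨ ⟪⟫-lift₂ _∷_ (f *F f′) (tensor (zipWith _*F_ fs fs′)) g ⟨
    ⟪ tensor (zipWith _*F_ (f ∷ fs) (f′ ∷ fs′)) ∣ g ⟫ ∎
    where
    g′ : Word → Word → Basis n → Basis n → R
    g′ w w′ ws ws′ = g ((w ++ w′) ∷ zipWith _++_ ws ws′)

  tensor-cong : ∀ {n} (fs fs′ : Vec F n) → (∀ i → lookup fs i ≐ lookup fs′ i) → tensor fs ≐ tensor fs′
  tensor-cong []       []         _      g = ≈-refl
  tensor-cong (f ∷ fs) (f′ ∷ fs′) fs≐fs′ g = begin
    ⟪ tensor (f ∷ fs) ∣ g ⟫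
      ≈⟨ ⟪⟫-lift₂ _∷_ f (tensor fs) g ⟩
    ⟪ f ∣ (λ w → ⟪ tensor fs ∣ (λ ws → g (w ∷ ws)) ⟫) ⟫
      ≈⟨ ⟪⟫-cong f (λ w → tensor-cong fs fs′ (fs≐fs′ ∘ suc) (λ ws → g (w ∷ ws))) ⟩
    ⟪ f ∣ (λ w → ⟪ tensor fs′ ∣ (λ ws → g (w ∷ ws)) ⟫) ⟫
      ≈⟨ fs≐fs′ zero _ ⟩
    ⟪ f′ ∣ (λ w → ⟪ tensor fs′ ∣ (λ ws → g (w ∷ ws)) ⟫) ⟫
      ≈⟨ ⟪⟫-lift₂ _∷_ f′ (tensor fs′) g ⟨
    ⟪ tensor (f′ ∷ fs′) ∣ g ⟫ ∎

  coeff≈⟪⟫ : ∀ {n} (a : T n) w → coeff a w ≈ ⟪ a ∣ (λ u → [ ⌊ u ≟B w ⌋ ]· 1#) ⟫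
  coeff≈⟪⟫ []            w = ≈-refl
  coeff≈⟪⟫ ((x , u) ∷ a) w with ⌊ u ≟B w ⌋
  ... | true  = +-cong (sym (*-identityʳ x)) (coeff≈⟪⟫ a w)
  ... | false = trans (coeff≈⟪⟫ a w) (trans (sym (+-identityˡ _)) (+-congʳ (sym (zeroʳ x))))

  ≐⇒≋ : ∀ {n} (a b : T n) → a ≐ b → a ≋ b
  ≐⇒≋ a b a≐b w = trans (coeff≈⟪⟫ a w) (trans (a≐b _) (sym (coeff≈⟪⟫ b w)))

  choices : (p n : ℕ) → List (Vec (Fin (suc p)) n)
  choices p = vecsOver (allFin (suc p))

  monomial : ∀ {p n} → Vec F p → Vec (Fin (suc p)) n → T n
  monomial f c = tensor (V.map (choice f) c)

  ⟪⟫-e : ∀ n {p} (β : Vec ℕ p) (f : Vec F p) g →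
         ⟪ e n β f ∣ g ⟫ ≈ Σ[ c ← choices p n ] [ hasMultidegree β c ]· ⟪ monomial f c ∣ g ⟫
  ⟪⟫-e n {p} β f g = trans (⟪⟫-concatMap (monomial f) (boolFilter (hasMultidegree β) (choices p n)) g)
                             (ΣL-boolFilter (hasMultidegree β) (choices p n) _)

  module _ {h k : ℕ} where
    open FinSum +-commutativeMonoid using (sum-syntax; sum-cong-≋; ∑-distrib-+)
    open CommSemigroupProps +-commutativeSemigroup using (x∙yz≈yx∙z)

    N : ℕ
    N = h ℕ.+ k ℕ.+ h ℕ.* k

    -- In one tensor factor of e^n_α(r) · e^n_β(s) the choices a (1 or rᵢ) and b (1 or sⱼ)
    -- produce the factor 1, rᵢ, sⱼ or rᵢsⱼ, whose choice index in e^n_γ(gens r s) is joinChoice a b.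
    joinChoice : Fin (suc h) → Fin (suc k) → Fin (suc N)
    joinChoice zero    zero    = zero
    joinChoice (suc i) zero    = suc (idx-i0 {h} {k} i)
    joinChoice zero    (suc j) = suc (idx-0j {h} {k} j)
    joinChoice (suc i) (suc j) = suc (idx-ij {h} {k} i j)

    splitChoice : Fin (suc N) → Fin (suc h) × Fin (suc k)
    splitChoice zero    = zero , zero
    splitChoice (suc t) =
      [ [ (λ i → suc i , zero) , (λ j → zero , suc j) ]′ ∘ splitAt h , Product.map suc suc ∘ remQuot k ]′
        (splitAt (h ℕ.+ k) t)

    splitChoice-joinChoice : ∀ a b → splitChoice (joinChoice a b) ≡ (a , b)
    splitChoice-joinChoice zero    zero = refl
    splitChoice-joinChoice (suc i) zero
      rewrite FinP.splitAt-↑ˡ (h ℕ.+ k) (i ↑ˡ k) (h ℕ.* k) | FinP.splitAt-↑ˡ h i k = refl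
    splitChoice-joinChoice zero    (suc j)
      rewrite FinP.splitAt-↑ˡ (h ℕ.+ k) (h ↑ʳ j) (h ℕ.* k) | FinP.splitAt-↑ʳ h k j = refl
    splitChoice-joinChoice (suc i) (suc j)
      rewrite FinP.splitAt-↑ʳ (h ℕ.+ k) (h ℕ.* k) (combine i j) =
      cong (Product.map suc suc) (FinP.remQuot-combine i j)

    joinChoice-injective : ∀ {a b a′ b′} → joinChoice a b ≡ joinChoice a′ b′ → a ≡ a′ × b ≡ b′
    joinChoice-injective {a} {b} {a′} {b′} eq =
      ,-injective (≡.trans (≡.sym (splitChoice-joinChoice a b))
                           (≡.trans (cong splitChoice eq) (splitChoice-joinChoice a′ b′)))

    ΣL-joinChoice : ∀ (H : Fin (suc N) → R) →
                    Σ[ a ← allFin (suc h) ] Σ[ b ← allFin (suc k) ] H (joinChoice a b) ≈ ΣL (allFin (suc N)) H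
    ΣL-joinChoice H = begin
      Σ[ a ← allFin (suc h) ] Σ[ b ← allFin (suc k) ] H (joinChoice a b)
        ≈⟨ reflexive (ΣL-allFin (suc h) (λ a → Σ[ b ← allFin (suc k) ] H (joinChoice a b))) ⟩
      ∑[ a < suc h ] (Σ[ b ← allFin (suc k) ] H (joinChoice a b))
        ≈⟨ sum-cong-≋ (λ a → reflexive (ΣL-allFin (suc k) (H ∘ joinChoice a))) ⟩
      (H zero + ∑[ j < k ] H₀ⱼ j) + ∑[ i < h ] (Hᵢ₀ i + ∑[ j < k ] Hᵢⱼ i j)
        ≈⟨ +-congˡ (∑-distrib-+ Hᵢ₀ (λ i → ∑[ j < k ] Hᵢⱼ i j)) ⟩
      (H zero + ∑[ j < k ] H₀ⱼ j) + (∑[ i < h ] Hᵢ₀ i + ∑[ i < h ] ∑[ j < k ] Hᵢⱼ i j)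
        ≈⟨ trans (+-assoc _ _ _) (+-congˡ (x∙yz≈yx∙z _ _ _)) ⟩
      H zero + ((∑[ i < h ] Hᵢ₀ i + ∑[ j < k ] H₀ⱼ j) + ∑[ i < h ] ∑[ j < k ] Hᵢⱼ i j)
        ≈⟨ +-congˡ (+-cong (∑-↑ h k (λ t → H (suc (t ↑ˡ h ℕ.* k))))
                            (∑-combine h k (λ u → H (suc (h ℕ.+ k ↑ʳ u))))) ⟨
      H zero + (∑[ t < h ℕ.+ k ] H (suc (t ↑ˡ h ℕ.* k)) + ∑[ u < h ℕ.* k ] H (suc (h ℕ.+ k ↑ʳ u)))
        ≈⟨ +-congˡ (∑-↑ (h ℕ.+ k) (h ℕ.* k) (H ∘ suc)) ⟨
      ∑[ z < suc N ] H z
        ≈⟨ reflexive (ΣL-allFin (suc N) H) ⟨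
      ΣL (allFin (suc N)) H ∎
      where
      Hᵢ₀ : Fin h → R
      Hᵢ₀ i = H (suc (idx-i0 {h} {k} i))
      H₀ⱼ : Fin k → R
      H₀ⱼ j = H (suc (idx-0j {h} {k} j))
      Hᵢⱼ : Fin h → Fin k → R
      Hᵢⱼ i j = H (suc (idx-ij {h} {k} i j))

    admissible-joinChoice : ∀ {n} (α : Vec ℕ h) (β : Vec ℕ k) c d →
                            admissible n α β (multidegree (zipWith joinChoice c d)) ≡
                            hasMultidegree α c ∧ hasMultidegree β d
    admissible-joinChoice {n} α β c d =
      cong₂ _∧_ (Equivalence.to T-≡ (ℕP.≤⇒≤ᵇ (sum-multidegree≤length cd)))
                (cong₂ _∧_ (allB-cong h (λ i → cong (_≡ᵇ lookup α i) (row-sum i)))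
                           (allB-cong k (λ j → cong (_≡ᵇ lookup β j) (column-sum j))))
      where
      cd : Vec (Fin (suc N)) n
      cd = zipWith joinChoice c d
      γ : Vec ℕ N
      γ = multidegree cd

      lookup-γ : ∀ t → lookup γ t ≡ countFin (suc t) cd
      lookup-γ = VecP.lookup∘tabulate _

      row-sum : ∀ i → lookup γ (idx-i0 {h} {k} i) ℕ.+ Σℕ k (λ j → lookup γ (idx-ij {h} {k} i j)) ≡
                      countFin (suc i) c
      row-sum i = ≡.trans (cong₂ ℕ._+_ (lookup-γ _) (Σℕ-cong k (lookup-γ ∘ idx-ij {h} {k} i)))
                          (countFin-marginalˡ joinChoice joinChoice-injective c d (suc i))

      column-sum : ∀ j → lookup γ (idx-0j {h} {k} j) ℕ.+ Σℕ h (λ i → lookup γ (idx-ij {h} {k} i j)) ≡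
                         countFin (suc j) d
      column-sum j = ≡.trans (cong₂ ℕ._+_ (lookup-γ _) (Σℕ-cong h (λ i → lookup-γ (idx-ij i j))))
                             (countFin-marginalʳ joinChoice joinChoice-injective c d (suc j))

    module _ (r : Vec F h) (s : Vec F k) where
      G : Vec F N
      G = gens r s

      -- gens r s unfolds to the tabulation of a where-bound function, which the ascription
      -- lets unification name; the splitAt equations then make that function compute.
      lookup-gens-i0 : ∀ i → lookup G (idx-i0 {h} {k} i) ≡ lookup r i
      lookup-gens-i0 i
        rewrite (lookup G (idx-i0 {h} {k} i) ≡ _ ∋ VecP.lookup∘tabulate {n = N} _ (idx-i0 {h} {k} i))
              | FinP.splitAt-↑ˡ (h ℕ.+ k) (i ↑ˡ k) (h ℕ.* k) | FinP.splitAt-↑ˡ h i k = refl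

      lookup-gens-0j : ∀ j → lookup G (idx-0j {h} {k} j) ≡ lookup s j
      lookup-gens-0j j
        rewrite (lookup G (idx-0j {h} {k} j) ≡ _ ∋ VecP.lookup∘tabulate {n = N} _ (idx-0j {h} {k} j))
              | FinP.splitAt-↑ˡ (h ℕ.+ k) (h ↑ʳ j) (h ℕ.* k) | FinP.splitAt-↑ʳ h k j = refl

      lookup-gens-ij : ∀ i j → lookup G (idx-ij {h} {k} i j) ≡ lookup r i *F lookup s j
      lookup-gens-ij i j
        rewrite (lookup G (idx-ij {h} {k} i j) ≡ _ ∋ VecP.lookup∘tabulate {n = N} _ (idx-ij {h} {k} i j))
              | FinP.splitAt-↑ʳ (h ℕ.+ k) (h ℕ.* k) (combine i j) =
        cong (λ (i′ , j′) → lookup r i′ *F lookup s j′) (FinP.remQuot-combine i j)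

      choice-gens : ∀ a b → choice r a *F choice s b ≐ choice G (joinChoice a b)
      choice-gens zero    zero                                   = *F-identityˡ oneF
      choice-gens (suc i) zero    rewrite lookup-gens-i0 i       = *F-identityʳ (lookup r i)
      choice-gens zero    (suc j) rewrite lookup-gens-0j j       = *F-identityˡ (lookup s j)
      choice-gens (suc i) (suc j) rewrite lookup-gens-ij i j     = λ g → ≈-refl

      monomial-*T : ∀ {n} (c : Vec (Fin (suc h)) n) d →
                    monomial r c *T monomial s d ≐ monomial G (zipWith joinChoice c d)
      monomial-*T {n} c d g =
        trans (tensor-*T (V.map (choice r) c) (V.map (choice s) d) g) (tensor-cong rs gs factor g)
        where
        rs gs : Vec F n
        rs = zipWith _*F_ (V.map (choice r) c) (V.map (choice s) d)
        gs = V.map (choice G) (zipWith joinChoice c d)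
        factor : ∀ i → lookup rs i ≐ lookup gs i
        factor i rewrite VecP.lookup-zipWith _*F_ i (V.map (choice r) c) (V.map (choice s) d)
                       | VecP.lookup-map i (choice r) c | VecP.lookup-map i (choice s) d
                       | VecP.lookup-map i (choice G) (zipWith joinChoice c d)
                       | VecP.lookup-zipWith joinChoice i c d = choice-gens (lookup c i) (lookup d i)

      admissibleSum : ∀ n → Vec ℕ h → Vec ℕ k → (Basis n → R) → R
      admissibleSum n α β g = Σ[ p ← choices N n ] [ admissible n α β (multidegree p) ]· ⟪ monomial G p ∣ g ⟫

      ⟪⟫-e-*T : ∀ n α β g → ⟪ e n α r *T e n β s ∣ g ⟫ ≈ admissibleSum n α β g
      ⟪⟫-e-*T n α β g = begin
        ⟪ e n α r *T e n β s ∣ g ⟫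
          ≈⟨ ⟪⟫-lift₂-bilinear (zipWith _++_) (monomial r) (monomial s) Cα Cβ g ⟩
        Σ[ c ← Cα ] Σ[ d ← Cβ ] ⟪ monomial r c *T monomial s d ∣ g ⟫
          ≈⟨ ΣL-cong Cα (λ c → ΣL-cong Cβ (λ d → monomial-*T c d g)) ⟩
        Σ[ c ← Cα ] Σ[ d ← Cβ ] X (zipWith joinChoice c d)
          ≈⟨ ΣL-boolFilter² (hasMultidegree α) (hasMultidegree β) (choices h n) (choices k n) _ ⟩
        Σ[ c ← choices h n ] Σ[ d ← choices k n ]
          [ hasMultidegree α c ∧ hasMultidegree β d ]· X (zipWith joinChoice c d)
          ≈⟨ ΣL-cong (choices h n) (λ c → ΣL-cong (choices k n) (λ d →
               reflexive (cong (λ b → [ b ]· X (zipWith joinChoice c d)) (≡.sym (admissible-joinChoice α β c d))))) ⟩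
        Σ[ c ← choices h n ] Σ[ d ← choices k n ] [ Q (zipWith joinChoice c d) ]· X (zipWith joinChoice c d)
          ≈⟨ ΣL-vecsOver-zipWith joinChoice _ _ _ ΣL-joinChoice n (λ p → [ Q p ]· X p) ⟩
        admissibleSum n α β g ∎
        where
        Cα : List (Vec (Fin (suc h)) n)
        Cα = boolFilter (hasMultidegree α) (choices h n)
        Cβ : List (Vec (Fin (suc k)) n)
        Cβ = boolFilter (hasMultidegree β) (choices k n)
        X : Vec (Fin (suc N)) n → R
        X p = ⟪ monomial G p ∣ g ⟫
        Q : Vec (Fin (suc N)) n → Bool
        Q p = admissible n α β (multidegree p)

      ⟪⟫-ΣT-e : ∀ n α β g → ⟪ ΣT (admissibleγs n α β) (λ γ → e n γ G) ∣ g ⟫ ≈ admissibleSum n α β g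
      ⟪⟫-ΣT-e n α β g = begin
        ⟪ ΣT (admissibleγs n α β) (λ γ → e n γ G) ∣ g ⟫
          ≈⟨ ⟪⟫-concatMap (λ γ → e n γ G) (admissibleγs n α β) g ⟩
        Σ[ γ ← admissibleγs n α β ] ⟪ e n γ G ∣ g ⟫
          ≈⟨ ΣL-cong (admissibleγs n α β) (λ γ → ⟪⟫-e n γ G g) ⟩
        Σ[ γ ← admissibleγs n α β ] Σ[ p ← choices N n ] [ hasMultidegree γ p ]· X p
          ≈⟨ ΣL-boolFilter (admissible n α β) Γ _ ⟩
        Σ[ γ ← Γ ] [ admissible n α β γ ]· Σ[ p ← choices N n ] [ hasMultidegree γ p ]· X p
          ≈⟨ ΣL-cong Γ (λ γ → ΣL-[]· (admissible n α β γ) (choices N n) _) ⟨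
        Σ[ γ ← Γ ] Σ[ p ← choices N n ] [ admissible n α β γ ]· [ hasMultidegree γ p ]· X p
          ≈⟨ ΣL-comm Γ (choices N n) _ ⟩
        Σ[ p ← choices N n ] Σ[ γ ← Γ ] [ admissible n α β γ ]· [ hasMultidegree γ p ]· X p
          ≈⟨ ΣL-cong (choices N n) (λ p → ΣL-cong Γ (λ γ →
               reflexive ([]·-comm (admissible n α β γ) (hasMultidegree γ p) (X p)))) ⟩
        Σ[ p ← choices N n ] Σ[ γ ← Γ ] [ hasMultidegree γ p ]· [ admissible n α β γ ]· X p
          ≈⟨ ΣL-cong (choices N n) (λ p →
               ΣL-vecsOver-≡ᵇ N (λ q → countFin (suc q) p) (λ γ → [ admissible n α β γ ]· X p)
                              (upTo⁺ (suc n)) (λ q → ∈-upTo⁺ (ℕ.s≤s (countFin≤length (suc q) p)))) ⟩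
        admissibleSum n α β g ∎
        where
        Γ : List (Vec ℕ N)
        Γ = vecsOver (upTo (suc n)) N
        X : Vec (Fin (suc N)) n → R
        X p = ⟪ monomial G p ∣ g ⟫

mainTheorem7 : ∀ {c ℓ} (K : CommutativeRing c ℓ) (m n h k : ℕ)
                 (α : Vec ℕ h) (β : Vec ℕ k) (r : Vec (Alg.F K m) h) (s : Vec (Alg.F K m) k) →
                 1 ≤ n → sum α ≤ n → sum β ≤ n →
                 Alg._≋_ K m (Alg._*T_ K m (Alg.e K m n α r) (Alg.e K m n β s))
                   (Alg.ΣT K m (Alg.admissibleγs K m n α β) (λ γ → Alg.e K m n γ (Alg.gens K m r s)))
mainTheorem7 K m n h k α β r s _ _ _ =
  ≐⇒≋ (e n α r *T e n β s) (ΣT (admissibleγs n α β) (λ γ → e n γ (gens r s)))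
      (λ g → trans (⟪⟫-e-*T r s n α β g) (sym (⟪⟫-ΣT-e r s n α β g)))
  where
  open Alg K m
  open Expansion K m
  open CommutativeRing K using (trans; sym)
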